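{- Let $G$ be a finite simple graph with $n$ vertices and $\alpha(G)>n/2$. Then the following are equivalent: (i) $G$ is $\alpha^{+}$-stable; (ii) $\xi(G)=1$; (iii) $G$ has a unique isolated vertex $v$, $\xi(G-v)=0$, and $\alpha(G-v)=(n-1)/2$.
   Context: $\alpha(G)$ is the maximum size of a stable set of $G$; $\Omega(G)$ is the set of maximum stable sets; $core(G)=\bigcap\{S:S\in\Omega(G)\}$ and $\xi(G)=|core(G)|$. $G$ is $\alpha^{+}$-stable if $\alpha(G+e)=\alpha(G)$ for every edge $e$ of the complement $\overline{G}$. $G-v$ is the graph obtained by deleting vertex $v$. -}

module Defs where

open import Data.Bool using (Bool; true; false; _∧_; _∨_; not; if_then_else_)
open import Data.Nat using (ℕ; zero; suc; _⊔_; pred)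
open import Data.Fin using (Fin; zero; suc; punchIn; _≟_)
open import Data.Fin.Subset using (Subset; ∣_∣; ⋂)
open import Data.List using (List; []; _∷_; map; _++_; filter; foldr; allFin)
open import Data.Vec using (Vec; []; _∷_; lookup)
open import Relation.Nullary.Decidable using (⌊_⌋)
open import Relation.Binary.PropositionalEquality using (_≡_; refl)

Adj : ℕ → Set
Adj n = Fin n → Fin n → Bool

record Graph (n : ℕ) : Set where
  field
    adj    : Adj n
    sym    : ∀ i j → adj i j ≡ adj j i
    irrefl : ∀ i → adj i i ≡ false
open Graph public

allSubsets : (n : ℕ) → List (Subset n)
allSubsets zero    = [] ∷ []
allSubsets (suc n) = map (true ∷_) (allSubsets n) ++ map (false ∷_) (allSubsets n)

allB : ∀ {A : Set} → (A → Bool) → List A → Bool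
allB p = foldr (λ x b → p x ∧ b) true

isStable : ∀ {n} → Adj n → Subset n → Bool
isStable {n} A S =
  allB (λ i → allB (λ j → not (lookup S i ∧ lookup S j ∧ A i j)) (allFin n)) (allFin n)

stableSets : ∀ {n} → Adj n → List (Subset n)
stableSets {n} A = filter (λ S → isStable A S ≟ᵇ true) (allSubsets n)
  where
  open import Data.Bool using () renaming (_≟_ to _≟ᵇ_)

α : ∀ {n} → Adj n → ℕ
α A = foldr _⊔_ 0 (map ∣_∣ (stableSets A))

Ω : ∀ {n} → Adj n → List (Subset n)
Ω A = filter (λ S → ∣ S ∣ ≟ℕ α A) (stableSets A)
  where
  open import Data.Nat using () renaming (_≟_ to _≟ℕ_)

core : ∀ {n} → Adj n → Subset n
core A = ⋂ (Ω A)

ξ : ∀ {n} → Adj n → ℕ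
ξ A = ∣ core A ∣

addEdge : ∀ {n} → Adj n → Fin n → Fin n → Adj n
addEdge A u v i j =
  A i j ∨ (⌊ i ≟ u ⌋ ∧ ⌊ j ≟ v ⌋) ∨ (⌊ i ≟ v ⌋ ∧ ⌊ j ≟ u ⌋)

α⁺-stable : ∀ {n} → Graph n → Set
α⁺-stable {n} G =
  (u v : Fin n) → (u ≡ v → Data.Empty.⊥) → adj G u v ≡ false →
  α (addEdge (adj G) u v) ≡ α (adj G)
  where import Data.Empty

_-ᵥ_ : ∀ {n} → Graph n → Fin n → Graph (pred n)
_-ᵥ_ {suc n} G v = record
  { adj    = λ i j → adj G (punchIn v i) (punchIn v j)
  ; sym    = λ i j → sym G (punchIn v i) (punchIn v j)
  ; irrefl = λ i → irrefl G (punchIn v i)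
  }

Isolated : ∀ {n} → Graph n → Fin n → Set
Isolated G v = ∀ u → adj G v u ≡ false

{-# OPTIONS --safe #-}
module Submission where

open import Defs
open import Data.Nat using (ℕ; _*_; _<_; _∸_)
open import Data.Fin using (Fin)
open import Data.Product using (Σ; _×_)
open import Function.Bundles using (_⇔_)
open import Relation.Binary.PropositionalEquality using (_≡_)

open import Data.Bool as Bool using (Bool; true; false; _∧_; not)
open import Data.Bool.Properties using (T-≡; ¬-not; ∨-conicalˡ; ∧-conicalˡ; ∧-conicalʳ; ∧-zeroʳ; ∨-zeroʳ)
open import Data.Nat as ℕ using (suc; _+_; _≤_; z≤n; s≤s; _⊔_)
open import Data.Nat.Properties
  using (+-suc; +-comm; +-assoc; +-mono-≤; +-monoˡ-≤; +-monoʳ-≤; +-cancelˡ-≤; *-suc; suc-injective;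
         ≤-refl; ≤-reflexive; ≤-trans; ≤-antisym; ≤-pred; n≤1+n; m≤m+n; n≮0; <⇒≱;
         m≤m⊔n; m≤n⇒m≤o⊔n; ⊔-sel; ⊔-identityʳ; module ≤-Reasoning)
open import Data.Nat.Tactic.RingSolver using (solve-∀)
open import Data.Fin using (zero; suc; punchIn; punchOut; _≟_)
open import Data.Fin.Properties as Fin using (any?; punchIn-punchOut; punchInᵢ≢i)
open import Data.Fin.Subset
open import Data.Fin.Subset.Properties
open import Data.List using (List; []; _∷_; map; foldr; allFin)
open import Data.List.Membership.Propositional using () renaming (_∈_ to _∈ˡ_)
open import Data.List.Membership.Propositional.Properties
  using (∈-filter⁺; ∈-filter⁻; ∈-map⁺; ∈-++⁺ˡ; ∈-++⁺ʳ; ∈-allFin)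
open import Data.List.Relation.Unary.Any as Any using ()
open import Data.Product using (_,_; proj₁; proj₂; ∃; ∃-syntax)
open import Data.Sum using (_⊎_; inj₁; inj₂)
open import Data.Vec using (Vec; []; _∷_; lookup; tabulate; insertAt; removeAt; here; there)
open import Data.Vec.Properties using (lookup⇒[]=; []=⇒lookup; lookup∘tabulate; insertAt-punchIn)
open import Function using (_∘_)
open import Function.Bundles using (mk⇔; Equivalence)
open import Relation.Nullary using (yes; no; contradiction)
open import Relation.Nullary.Decidable using (⌊_⌋; _×-dec_; toWitness; fromWitness; decidable-stable)
open import Relation.Unary using (Pred; Decidable)
open import Relation.Binary.PropositionalEquality as ≡ using (refl; cong; subst; _≢_; module ≡-Reasoning)

-- Write d(a) = ∣ a ∣ − ∣ N a ∣ for a stable set a.  If t is a maximum stable set and c = a ─ t,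
-- then (t ─ N c) ∪ c is stable, so maximality of t gives ∣ c ∣ ≤ ∣ t ∩ N c ∣; as N (a ∩ t) and
-- t ∩ N c are disjoint parts of N a, it follows that d(a ∩ t) ≥ d(a).  Intersecting a maximum
-- stable set S with every maximum stable set in turn yields d(core) ≥ d(S) ≥ 2α − n.  Hence
-- α > n/2 forces ∣ N core ∣ < ξ: the core is nonempty, and if ξ = 1 its vertex is isolated and
-- 2α = n + 1.  Adding a non-edge uw lowers α exactly when u and w both lie in the core, so
-- α⁺-stability means ξ ≤ 1.  Deleting an isolated vertex v lowers α by one and moves the rest
-- of the core along punchIn v, so core G = ⁅ v ⁆ exactly when G - v has empty core.

private
  variable
    X : Set
    n : ℕ
    p q S T : Subset n
    x y : Fin n

-- Finite subsets

∈-resp-lookup : ∀ {m} {p : Subset n} {q : Subset m} {y} → lookup p x ≡ lookup q y → x ∈ p → y ∈ q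
∈-resp-lookup {q = q} {y} eq x∈p = lookup⇒[]= y q (≡.trans (≡.sym eq) ([]=⇒lookup x∈p))

∣p∣≡∣p∩q∣+∣p─q∣ : ∀ (p q : Subset n) → ∣ p ∣ ≡ ∣ p ∩ q ∣ + ∣ p ─ q ∣
∣p∣≡∣p∩q∣+∣p─q∣ []            []            = refl
∣p∣≡∣p∩q∣+∣p─q∣ (inside  ∷ p) (inside  ∷ q) = cong suc (∣p∣≡∣p∩q∣+∣p─q∣ p q)
∣p∣≡∣p∩q∣+∣p─q∣ (inside  ∷ p) (outside ∷ q) =
  ≡.trans (cong suc (∣p∣≡∣p∩q∣+∣p─q∣ p q)) (≡.sym (+-suc _ _))
∣p∣≡∣p∩q∣+∣p─q∣ (outside ∷ p) (inside  ∷ q) = ∣p∣≡∣p∩q∣+∣p─q∣ p q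
∣p∣≡∣p∩q∣+∣p─q∣ (outside ∷ p) (outside ∷ q) = ∣p∣≡∣p∩q∣+∣p─q∣ p q

∣p∪q∣≡∣p∣+∣q∣ : ∀ (p q : Subset n) → (∀ {x} → x ∈ p → x ∉ q) → ∣ p ∪ q ∣ ≡ ∣ p ∣ + ∣ q ∣
∣p∪q∣≡∣p∣+∣q∣ []            []            _        = refl
∣p∪q∣≡∣p∣+∣q∣ (inside  ∷ p) (inside  ∷ q) disjoint = contradiction here (disjoint here)
∣p∪q∣≡∣p∣+∣q∣ (inside  ∷ p) (outside ∷ q) disjoint =
  cong suc (∣p∪q∣≡∣p∣+∣q∣ p q λ x∈p x∈q → disjoint (there x∈p) (there x∈q))
∣p∪q∣≡∣p∣+∣q∣ (outside ∷ p) (inside  ∷ q) disjoint =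
  ≡.trans (cong suc (∣p∪q∣≡∣p∣+∣q∣ p q λ x∈p x∈q → disjoint (there x∈p) (there x∈q)))
          (≡.sym (+-suc _ _))
∣p∪q∣≡∣p∣+∣q∣ (outside ∷ p) (outside ∷ q) disjoint =
  ∣p∪q∣≡∣p∣+∣q∣ p q λ x∈p x∈q → disjoint (there x∈p) (there x∈q)

x∈p─q⇒x∉q : x ∈ p ─ q → x ∉ q
x∈p─q⇒x∉q {p = _ ∷ _} {inside ∷ _} ()          here
x∈p─q⇒x∉q {p = _ ∷ p} {_ ∷ q}      (there x∈) (there x∈q) = x∈p─q⇒x∉q {p = p} {q} x∈ x∈q

Empty⇒∣p∣≡0 : Empty p → ∣ p ∣ ≡ 0
Empty⇒∣p∣≡0 {n} p=∅ = ≡.trans (cong ∣_∣ (Empty-unique p=∅)) (∣⊥∣≡0 n)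

x∈p⇒0<∣p∣ : x ∈ p → 0 < ∣ p ∣
x∈p⇒0<∣p∣ x∈p = ≤-trans (s≤s z≤n) (x∈p⇒∣p-x∣<∣p∣ x∈p)

0<∣p∣⇒Nonempty : 0 < ∣ p ∣ → Nonempty p
0<∣p∣⇒Nonempty {p = p} 0<∣p∣ with nonempty? p
... | yes p≠∅ = p≠∅
... | no  p=∅ = contradiction (subst (0 <_) (Empty⇒∣p∣≡0 p=∅) 0<∣p∣) n≮0

x∈p∧y∈p∧x≢y⇒1<∣p∣ : x ∈ p → y ∈ p → x ≢ y → 1 < ∣ p ∣
x∈p∧y∈p∧x≢y⇒1<∣p∣ x∈p y∈p x≢y =
  ≤-trans (s≤s (x∈p⇒0<∣p∣ (x∈p∧x≢y⇒x∈p-y y∈p (x≢y ∘ ≡.sym)))) (x∈p⇒∣p-x∣<∣p∣ x∈p)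

subsingleton⇒∣p∣≤1 : (∀ {x y} → x ∈ p → y ∈ p → x ≡ y) → ∣ p ∣ ≤ 1
subsingleton⇒∣p∣≤1 {p = []}          _    = z≤n
subsingleton⇒∣p∣≤1 {p = inside  ∷ p} uniq =
  s≤s (≤-reflexive (Empty⇒∣p∣≡0 λ (x , x∈p) → Fin.0≢1+n (uniq here (there x∈p))))
subsingleton⇒∣p∣≤1 {p = outside ∷ p} uniq =
  subsingleton⇒∣p∣≤1 λ x∈p y∈p → Fin.suc-injective (uniq (there x∈p) (there y∈p))

unique-member⇒p≡⁅x⁆ : x ∈ p → (∀ {y} → y ∈ p → y ≡ x) → p ≡ ⁅ x ⁆
unique-member⇒p≡⁅x⁆ {x = x} x∈p uniq =
  ⊆-antisym (λ y∈p → subst (_∈ ⁅ x ⁆) (≡.sym (uniq y∈p)) (x∈⁅x⁆ x))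
            (λ y∈⁅x⁆ → subst (_∈ _) (≡.sym (x∈⁅y⁆⇒x≡y x y∈⁅x⁆)) x∈p)

∣p∣≡1⇒p≡⁅x⁆ : ∣ p ∣ ≡ 1 → ∃[ x ] p ≡ ⁅ x ⁆
∣p∣≡1⇒p≡⁅x⁆ {p = p} ∣p∣≡1 with 0<∣p∣⇒Nonempty (≤-reflexive (≡.sym ∣p∣≡1))
... | x , x∈p = x , unique-member⇒p≡⁅x⁆ x∈p λ {y} y∈p → decidable-stable (y ≟ x) λ y≢x →
  <⇒≱ (subst (1 <_) ∣p∣≡1 (x∈p∧y∈p∧x≢y⇒1<∣p∣ y∈p x∈p y≢x)) ≤-refl

lookup-removeAt : ∀ (xs : Vec X (suc n)) i j → lookup (removeAt xs i) j ≡ lookup xs (punchIn i j)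
lookup-removeAt (x ∷ xs)     zero     j       = refl
lookup-removeAt (x ∷ [])     (suc ()) j
lookup-removeAt (x ∷ y ∷ xs) (suc i)  zero    = refl
lookup-removeAt (x ∷ y ∷ xs) (suc i)  (suc j) = lookup-removeAt (y ∷ xs) i j

∈-insertAt⁻ : ∀ (p : Subset n) i {s} → x ∈ insertAt p i s → x ≡ i ⊎ ∃[ j ] x ≡ punchIn i j × j ∈ p
∈-insertAt⁻ {x = x} p i {s} x∈ with i ≟ x
... | yes i≡x = inj₁ (≡.sym i≡x)
... | no  i≢x = inj₂ (punchOut i≢x , ≡.sym punchIn≡x , ∈-resp-lookup lookup≡ x∈)
  where
  punchIn≡x : punchIn i (punchOut i≢x) ≡ x
  punchIn≡x = punchIn-punchOut i≢x
  lookup≡ : lookup (insertAt p i s) x ≡ lookup p (punchOut i≢x)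
  lookup≡ = ≡.trans (cong (lookup (insertAt p i s)) (≡.sym punchIn≡x))
                    (insertAt-punchIn p i s (punchOut i≢x))

∣insertAt-inside∣≡1+∣p∣ : ∀ (p : Subset n) i → ∣ insertAt p i inside ∣ ≡ suc ∣ p ∣
∣insertAt-inside∣≡1+∣p∣ p             zero    = refl
∣insertAt-inside∣≡1+∣p∣ (inside  ∷ p) (suc i) = cong suc (∣insertAt-inside∣≡1+∣p∣ p i)
∣insertAt-inside∣≡1+∣p∣ (outside ∷ p) (suc i) = ∣insertAt-inside∣≡1+∣p∣ p i

∣p∣≤1+∣removeAt∣ : ∀ (p : Subset (suc n)) i → ∣ p ∣ ≤ suc ∣ removeAt p i ∣
∣p∣≤1+∣removeAt∣ (inside  ∷ p)     zero     = ≤-refl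
∣p∣≤1+∣removeAt∣ (outside ∷ p)     zero     = n≤1+n ∣ p ∣
∣p∣≤1+∣removeAt∣ (s ∷ [])          (suc ())
∣p∣≤1+∣removeAt∣ (inside  ∷ t ∷ p) (suc i)  = s≤s (∣p∣≤1+∣removeAt∣ (t ∷ p) i)
∣p∣≤1+∣removeAt∣ (outside ∷ t ∷ p) (suc i)  = ∣p∣≤1+∣removeAt∣ (t ∷ p) i

x∈⋂⁺ : ∀ (ps : List (Subset n)) → (∀ {p} → p ∈ˡ ps → x ∈ p) → x ∈ ⋂ ps
x∈⋂⁺ []       _      = ∈⊤
x∈⋂⁺ (p ∷ ps) x∈all = x∈p∩q⁺ (x∈all (Any.here refl) , x∈⋂⁺ ps (x∈all ∘ Any.there))

x∈⋂⁻ : ∀ (ps : List (Subset n)) {p} → x ∈ ⋂ ps → p ∈ˡ ps → x ∈ p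
x∈⋂⁻ (p ∷ ps) x∈⋂ (Any.here refl)  = proj₁ (x∈p∩q⁻ p (⋂ ps) x∈⋂)
x∈⋂⁻ (p ∷ ps) x∈⋂ (Any.there q∈ps) = x∈⋂⁻ ps (proj₂ (x∈p∩q⁻ p (⋂ ps) x∈⋂)) q∈ps

x∉⋂⁻ : ∀ (ps : List (Subset n)) → x ∉ ⋂ ps → ∃[ p ] p ∈ˡ ps × x ∉ p
x∉⋂⁻ []                x∉⋂ = contradiction ∈⊤ x∉⋂
x∉⋂⁻ {x = x} (p ∷ ps) x∉⋂ with x ∈? p
... | no  x∉p = p , Any.here refl , x∉p
... | yes x∈p with x∉⋂⁻ ps (λ x∈⋂ps → x∉⋂ (x∈p∩q⁺ (x∈p , x∈⋂ps)))
...   | q , q∈ps , x∉q = q , Any.there q∈ps , x∉q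

module _ {ℓ} {P : Pred (Fin n) ℓ} (P? : Decidable P) where

  ∈-tabulate⁺ : P x → x ∈ tabulate (λ y → ⌊ P? y ⌋)
  ∈-tabulate⁺ {x} px =
    lookup⇒[]= x _ (≡.trans (lookup∘tabulate _ x) (Equivalence.to T-≡ (fromWitness px)))

  ∈-tabulate⁻ : x ∈ tabulate (λ y → ⌊ P? y ⌋) → P x
  ∈-tabulate⁻ {x} x∈ =
    toWitness (Equivalence.from T-≡ (≡.trans (≡.sym (lookup∘tabulate _ x)) ([]=⇒lookup x∈)))

module _ {X : Set} (f : X → ℕ) where

  foldr-⊔-upper : ∀ {x xs} → x ∈ˡ xs → f x ≤ foldr _⊔_ 0 (map f xs)
  foldr-⊔-upper (Any.here refl)  = m≤m⊔n _ _
  foldr-⊔-upper (Any.there x∈xs) = m≤n⇒m≤o⊔n _ (foldr-⊔-upper x∈xs)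

  foldr-⊔-attained : ∀ {x xs} → x ∈ˡ xs → ∃[ y ] y ∈ˡ xs × f y ≡ foldr _⊔_ 0 (map f xs)
  foldr-⊔-attained {xs = y ∷ ys} _ = attained y ys
    where
    attained : ∀ y ys → ∃[ z ] z ∈ˡ y ∷ ys × f z ≡ foldr _⊔_ 0 (map f (y ∷ ys))
    attained y []        = y , Any.here refl , ≡.sym (⊔-identityʳ (f y))
    attained y (y′ ∷ ys) with ⊔-sel (f y) (foldr _⊔_ 0 (map f (y′ ∷ ys)))
    ... | inj₁ y-wins    = y , Any.here refl , ≡.sym y-wins
    ... | inj₂ rest-wins with attained y′ ys
    ...   | z , z∈ , fz≡ = z , Any.there z∈ , ≡.trans fz≡ (≡.sym rest-wins)

-- Stable sets, α and the core

Stable : Adj n → Subset n → Set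
Stable A S = ∀ {i j} → i ∈ S → j ∈ S → A i j ≡ false

Maximum : Adj n → Subset n → Set
Maximum A S = Stable A S × ∣ S ∣ ≡ α A

allB⁺ : (f : X → Bool) (xs : List X) → (∀ x → f x ≡ true) → allB f xs ≡ true
allB⁺ f []       _    = refl
allB⁺ f (x ∷ xs) f≡tt rewrite f≡tt x = allB⁺ f xs f≡tt

allB⁻ : (f : X → Bool) (xs : List X) {x : X} → allB f xs ≡ true → x ∈ˡ xs → f x ≡ true
allB⁻ f (y ∷ xs) all≡tt (Any.here refl)  = ∧-conicalˡ _ _ all≡tt
allB⁻ f (y ∷ xs) all≡tt (Any.there x∈xs) = allB⁻ f xs (∧-conicalʳ (f y) _ all≡tt) x∈xs

not-∧-∧⁺ : ∀ {x y z} → (x ≡ true → y ≡ true → z ≡ false) → not (x ∧ y ∧ z) ≡ true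
not-∧-∧⁺ {true}  {true}  z≡ff rewrite z≡ff refl refl = refl
not-∧-∧⁺ {true}  {false} _    = refl
not-∧-∧⁺ {false}         _    = refl

not-∧-∧⁻ : ∀ {x y z} → not (x ∧ y ∧ z) ≡ true → x ≡ true → y ≡ true → z ≡ false
not-∧-∧⁻ {true} {true} {false} _ _ _ = refl

∈-allSubsets : ∀ (S : Subset n) → S ∈ˡ allSubsets n
∈-allSubsets []                    = Any.here refl
∈-allSubsets {suc n} (inside  ∷ S) = ∈-++⁺ˡ (∈-map⁺ (inside ∷_) (∈-allSubsets S))
∈-allSubsets {suc n} (outside ∷ S) =
  ∈-++⁺ʳ (map (inside ∷_) (allSubsets n)) (∈-map⁺ (outside ∷_) (∈-allSubsets S))

module _ (A : Adj n) where

  Stable-⊆ : S ⊆ T → Stable A T → Stable A S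
  Stable-⊆ S⊆T stable i∈S j∈S = stable (S⊆T i∈S) (S⊆T j∈S)

  ⊥-stable : Stable A ⊥
  ⊥-stable i∈⊥ = contradiction i∈⊥ ∉⊥

  isStable⇒Stable : isStable A S ≡ true → Stable A S
  isStable⇒Stable isStable≡tt {i} {j} i∈S j∈S =
    not-∧-∧⁻ (allB⁻ _ (allFin n) (allB⁻ _ (allFin n) isStable≡tt (∈-allFin i)) (∈-allFin j))
             ([]=⇒lookup i∈S) ([]=⇒lookup j∈S)

  Stable⇒isStable : Stable A S → isStable A S ≡ true
  Stable⇒isStable {S} stable = allB⁺ _ (allFin n) λ i → allB⁺ _ (allFin n) λ j →
    not-∧-∧⁺ λ Si Sj → stable (lookup⇒[]= i S Si) (lookup⇒[]= j S Sj)

  ∈-stableSets⁺ : Stable A S → S ∈ˡ stableSets A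
  ∈-stableSets⁺ {S} stable =
    ∈-filter⁺ (λ S → isStable A S Bool.≟ true) (∈-allSubsets S) (Stable⇒isStable stable)

  ∈-stableSets⁻ : S ∈ˡ stableSets A → Stable A S
  ∈-stableSets⁻ S∈ =
    isStable⇒Stable (proj₂ (∈-filter⁻ (λ S → isStable A S Bool.≟ true) {xs = allSubsets n} S∈))

  Stable⇒∣S∣≤α : Stable A S → ∣ S ∣ ≤ α A
  Stable⇒∣S∣≤α = foldr-⊔-upper ∣_∣ ∘ ∈-stableSets⁺

  Stable∧α≤∣S∣⇒Maximum : Stable A S → α A ≤ ∣ S ∣ → Maximum A S
  Stable∧α≤∣S∣⇒Maximum stable α≤∣S∣ = stable , ≤-antisym (Stable⇒∣S∣≤α stable) α≤∣S∣

  maximum-exists : ∃ (Maximum A)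
  maximum-exists with foldr-⊔-attained ∣_∣ (∈-stableSets⁺ ⊥-stable)
  ... | S , S∈ , ∣S∣≡α = S , ∈-stableSets⁻ S∈ , ∣S∣≡α

  ∈-Ω⁺ : Maximum A S → S ∈ˡ Ω A
  ∈-Ω⁺ (stable , ∣S∣≡α) = ∈-filter⁺ (λ S → ∣ S ∣ ℕ.≟ α A) (∈-stableSets⁺ stable) ∣S∣≡α

  ∈-Ω⁻ : S ∈ˡ Ω A → Maximum A S
  ∈-Ω⁻ S∈Ω with ∈-filter⁻ (λ S → ∣ S ∣ ℕ.≟ α A) {xs = stableSets A} S∈Ω
  ... | S∈ , ∣S∣≡α = ∈-stableSets⁻ S∈ , ∣S∣≡α

  ∈-core⁺ : (∀ {S} → Maximum A S → x ∈ S) → x ∈ core A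
  ∈-core⁺ x∈maximum = x∈⋂⁺ (Ω A) (x∈maximum ∘ ∈-Ω⁻)

  ∈-core⁻ : x ∈ core A → Maximum A S → x ∈ S
  ∈-core⁻ x∈core = x∈⋂⁻ (Ω A) x∈core ∘ ∈-Ω⁺

  ∉-core⁻ : x ∉ core A → ∃[ S ] Maximum A S × x ∉ S
  ∉-core⁻ x∉core with x∉⋂⁻ (Ω A) x∉core
  ... | S , S∈Ω , x∉S = S , ∈-Ω⁻ S∈Ω , x∉S

  core-stable : Stable A (core A)
  core-stable with maximum-exists
  ... | S , max-S@(stable , _) = Stable-⊆ (λ x∈core → ∈-core⁻ x∈core max-S) stable

  maximum∩core≡core : Maximum A S → S ∩ core A ≡ core A
  maximum∩core≡core max-S =
    ⊆-antisym (p∩q⊆q _ _) (λ x∈core → x∈p∩q⁺ (∈-core⁻ x∈core max-S , x∈core))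

-- Neighbourhoods and surplus

N : Adj n → Subset n → Subset n
N A S = tabulate λ j → ⌊ any? (λ i → i ∈? S ×-dec A i j Bool.≟ true) ⌋

-- The surplus ∣ a ∣ − ∣ N a ∣ of a is at most that of b, stated without subtraction.
_≼[_]_ : Subset n → Adj n → Subset n → Set
a ≼[ A ] b = ∣ a ∣ + ∣ N A b ∣ ≤ ∣ b ∣ + ∣ N A a ∣

module _ (A : Adj n) where

  ∈N⁺ : ∀ {i j} → i ∈ S → A i j ≡ true → j ∈ N A S
  ∈N⁺ i∈S Aij = ∈-tabulate⁺ _ (_ , i∈S , Aij)

  ∈N⁻ : ∀ {j} → j ∈ N A S → ∃[ i ] i ∈ S × A i j ≡ true
  ∈N⁻ = ∈-tabulate⁻ _

  N-mono : S ⊆ T → N A S ⊆ N A T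
  N-mono S⊆T j∈NS with ∈N⁻ j∈NS
  ... | i , i∈S , Aij = ∈N⁺ (S⊆T i∈S) Aij

  N-disjoint : Stable A T → S ⊆ T → x ∈ T → x ∉ N A S
  N-disjoint stable S⊆T x∈T x∈NS with ∈N⁻ x∈NS
  ... | i , i∈S , Aix = contradiction (≡.trans (≡.sym Aix) (stable (S⊆T i∈S) x∈T)) λ ()

  ∣S∣+∣N[S]∣≤n : Stable A S → ∣ S ∣ + ∣ N A S ∣ ≤ n
  ∣S∣+∣N[S]∣≤n {S} stable = begin
    ∣ S ∣ + ∣ N A S ∣  ≡⟨ ≡.sym (∣p∪q∣≡∣p∣+∣q∣ S (N A S) (N-disjoint stable ⊆-refl)) ⟩
    ∣ S ∪ N A S ∣      ≤⟨ ∣p∣≤n (S ∪ N A S) ⟩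
    n                  ∎
    where open ≤-Reasoning

  ≼-trans : ∀ {a b c} → a ≼[ A ] b → b ≼[ A ] c → a ≼[ A ] c
  ≼-trans {a} {b} {c} a≼b b≼c = +-cancelˡ-≤ (∣ b ∣ + ∣ N A b ∣) _ _ (begin
    ∣ b ∣ + ∣ N A b ∣ + (∣ a ∣ + ∣ N A c ∣)  ≡⟨ shuffle₁ (∣ a ∣) (∣ N A b ∣) (∣ b ∣) (∣ N A c ∣) ⟩
    ∣ a ∣ + ∣ N A b ∣ + (∣ b ∣ + ∣ N A c ∣)  ≤⟨ +-mono-≤ a≼b b≼c ⟩
    ∣ b ∣ + ∣ N A a ∣ + (∣ c ∣ + ∣ N A b ∣)  ≡⟨ shuffle₂ (∣ b ∣) (∣ N A a ∣) (∣ c ∣) (∣ N A b ∣) ⟩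
    ∣ b ∣ + ∣ N A b ∣ + (∣ c ∣ + ∣ N A a ∣)  ∎)
    where
    open ≤-Reasoning
    shuffle₁ : ∀ w x y z → y + x + (w + z) ≡ w + x + (y + z)
    shuffle₁ = solve-∀
    shuffle₂ : ∀ w x y z → w + x + (y + z) ≡ w + z + (y + x)
    shuffle₂ = solve-∀

module _ (G : Graph n) where

  private
    A = adj G

  ─N∪-stable : ∀ {s c} → Stable A s → Stable A c → Stable A ((s ─ N A c) ∪ c)
  ─N∪-stable {s} {c} stable-s stable-c {i} {j} i∈ j∈
    with x∈p∪q⁻ (s ─ N A c) c i∈ | x∈p∪q⁻ (s ─ N A c) c j∈
  ... | inj₁ i∈s─Nc | inj₁ j∈s─Nc = stable-s (p─q⊆p s _ i∈s─Nc) (p─q⊆p s _ j∈s─Nc)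
  ... | inj₂ i∈c    | inj₂ j∈c    = stable-c i∈c j∈c
  ... | inj₁ i∈s─Nc | inj₂ j∈c    =
    ¬-not λ Aij → x∈p─q⇒x∉q {p = s} i∈s─Nc (∈N⁺ A j∈c (≡.trans (sym G j i) Aij))
  ... | inj₂ i∈c    | inj₁ j∈s─Nc = ¬-not λ Aij → x∈p─q⇒x∉q {p = s} j∈s─Nc (∈N⁺ A i∈c Aij)

  ∣c∣≤∣t∩N[c]∣ : ∀ {t c} → Maximum A t → Stable A c → (∀ {x} → x ∈ c → x ∉ t) →
                 ∣ c ∣ ≤ ∣ t ∩ N A c ∣
  ∣c∣≤∣t∩N[c]∣ {t} {c} (stable-t , ∣t∣≡α) stable-c c∩t=∅ = +-cancelˡ-≤ ∣ t ─ N A c ∣ _ _ (begin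
    ∣ t ─ N A c ∣ + ∣ c ∣          ≡⟨ ≡.sym (∣p∪q∣≡∣p∣+∣q∣ (t ─ N A c) c disjoint) ⟩
    ∣ (t ─ N A c) ∪ c ∣            ≤⟨ Stable⇒∣S∣≤α A (─N∪-stable stable-t stable-c) ⟩
    α A                            ≡⟨ ≡.sym ∣t∣≡α ⟩
    ∣ t ∣                          ≡⟨ ∣p∣≡∣p∩q∣+∣p─q∣ t (N A c) ⟩
    ∣ t ∩ N A c ∣ + ∣ t ─ N A c ∣  ≡⟨ +-comm ∣ t ∩ N A c ∣ _ ⟩
    ∣ t ─ N A c ∣ + ∣ t ∩ N A c ∣  ∎)
    where
    open ≤-Reasoning
    disjoint : x ∈ t ─ N A c → x ∉ c
    disjoint x∈ x∈c = c∩t=∅ x∈c (p─q⊆p t _ x∈)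

  ∣N[a∩t]∣+∣t∩N[a─t]∣≤∣N[a]∣ : ∀ a {t} → Stable A t → ∣ N A (a ∩ t) ∣ + ∣ t ∩ N A (a ─ t) ∣ ≤ ∣ N A a ∣
  ∣N[a∩t]∣+∣t∩N[a─t]∣≤∣N[a]∣ a {t} stable-t = begin
    ∣ N A (a ∩ t) ∣ + ∣ t ∩ N A (a ─ t) ∣  ≡⟨ ≡.sym (∣p∪q∣≡∣p∣+∣q∣ _ _ disjoint) ⟩
    ∣ N A (a ∩ t) ∪ (t ∩ N A (a ─ t)) ∣    ≤⟨ p⊆q⇒∣p∣≤∣q∣ ⊆N[a] ⟩
    ∣ N A a ∣                              ∎
    where
    open ≤-Reasoning
    disjoint : x ∈ N A (a ∩ t) → x ∉ t ∩ N A (a ─ t)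
    disjoint x∈N x∈t∩N = N-disjoint A stable-t (p∩q⊆q a t) (proj₁ (x∈p∩q⁻ t _ x∈t∩N)) x∈N
    ⊆N[a] : N A (a ∩ t) ∪ (t ∩ N A (a ─ t)) ⊆ N A a
    ⊆N[a] x∈ with x∈p∪q⁻ (N A (a ∩ t)) _ x∈
    ... | inj₁ x∈N[a∩t]   = N-mono A (p∩q⊆p a t) x∈N[a∩t]
    ... | inj₂ x∈t∩N[a─t] = N-mono A (p─q⊆p a t) (p∩q⊆q t _ x∈t∩N[a─t])

  ≼-∩-maximum : ∀ {a t} → Stable A a → Maximum A t → a ≼[ A ] (a ∩ t)
  ≼-∩-maximum {a} {t} stable-a max-t@(stable-t , _) = begin
    ∣ a ∣ + ∣ N A b ∣                     ≡⟨ cong (_+ ∣ N A b ∣) (∣p∣≡∣p∩q∣+∣p─q∣ a t) ⟩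
    ∣ b ∣ + ∣ c ∣ + ∣ N A b ∣             ≤⟨ +-monoˡ-≤ _ (+-monoʳ-≤ ∣ b ∣ ∣c∣≤∣t∩N[c]∣′) ⟩
    ∣ b ∣ + ∣ t ∩ N A c ∣ + ∣ N A b ∣     ≡⟨ +-assoc ∣ b ∣ _ _ ⟩
    ∣ b ∣ + (∣ t ∩ N A c ∣ + ∣ N A b ∣)   ≡⟨ cong (∣ b ∣ +_) (+-comm ∣ t ∩ N A c ∣ _) ⟩
    ∣ b ∣ + (∣ N A b ∣ + ∣ t ∩ N A c ∣)   ≤⟨ +-monoʳ-≤ ∣ b ∣ (∣N[a∩t]∣+∣t∩N[a─t]∣≤∣N[a]∣ a stable-t) ⟩
    ∣ b ∣ + ∣ N A a ∣                     ∎
    where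
    open ≤-Reasoning
    b c : Subset n
    b = a ∩ t
    c = a ─ t
    ∣c∣≤∣t∩N[c]∣′ : ∣ c ∣ ≤ ∣ t ∩ N A c ∣
    ∣c∣≤∣t∩N[c]∣′ = ∣c∣≤∣t∩N[c]∣ max-t (Stable-⊆ A (p─q⊆p a t) stable-a) (x∈p─q⇒x∉q {p = a})

  ≼-∩-⋂ : ∀ {a} ts → (∀ {t} → t ∈ˡ ts → Maximum A t) → Stable A a → a ≼[ A ] (a ∩ ⋂ ts)
  ≼-∩-⋂ {a} []       _       _        rewrite proj₂ ∩-identity a = ≤-refl
  ≼-∩-⋂ {a} (t ∷ ts) maximum stable-a rewrite ≡.sym (∩-assoc a t (⋂ ts)) =
    ≼-trans A {a} {a ∩ t} {(a ∩ t) ∩ ⋂ ts}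
      (≼-∩-maximum stable-a (maximum (Any.here refl)))
      (≼-∩-⋂ ts (maximum ∘ Any.there) (Stable-⊆ A (p∩q⊆p a t) stable-a))

  2α+∣N[core]∣≤n+ξ : 2 * α A + ∣ N A (core A) ∣ ≤ n + ξ A
  2α+∣N[core]∣≤n+ξ with maximum-exists A
  ... | S , max-S@(stable-S , ∣S∣≡α) = begin
    2 * α A + ∣ N A (core A) ∣        ≡⟨ cong (λ k → 2 * k + ∣ N A (core A) ∣) (≡.sym ∣S∣≡α) ⟩
    2 * ∣ S ∣ + ∣ N A (core A) ∣      ≡⟨ double ∣ S ∣ _ ⟩
    ∣ S ∣ + (∣ S ∣ + ∣ N A (core A) ∣) ≤⟨ +-monoʳ-≤ ∣ S ∣ S≼core ⟩
    ∣ S ∣ + (ξ A + ∣ N A S ∣)         ≡⟨ swap ∣ S ∣ (ξ A) _ ⟩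
    ∣ S ∣ + ∣ N A S ∣ + ξ A           ≤⟨ +-monoˡ-≤ (ξ A) (∣S∣+∣N[S]∣≤n A stable-S) ⟩
    n + ξ A                           ∎
    where
    open ≤-Reasoning
    S≼core : S ≼[ A ] core A
    S≼core = subst (S ≼[ A ]_) (maximum∩core≡core A max-S) (≼-∩-⋂ (Ω A) (∈-Ω⁻ A) stable-S)
    double : ∀ x y → 2 * x + y ≡ x + (x + y)
    double = solve-∀
    swap : ∀ x y z → x + (y + z) ≡ x + z + y
    swap = solve-∀

  ∣N[core]∣<ξ : n < 2 * α A → ∣ N A (core A) ∣ < ξ A
  ∣N[core]∣<ξ n<2α = +-cancelˡ-≤ n _ _ (begin
    n + suc ∣ N A (core A) ∣     ≡⟨ +-suc n _ ⟩
    suc n + ∣ N A (core A) ∣     ≤⟨ +-monoˡ-≤ _ n<2α ⟩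
    2 * α A + ∣ N A (core A) ∣   ≤⟨ 2α+∣N[core]∣≤n+ξ ⟩
    n + ξ A                      ∎)
    where open ≤-Reasoning

  2α≡1+n : n < 2 * α A → ξ A ≡ 1 → 2 * α A ≡ suc n
  2α≡1+n n<2α ξ≡1 = ≤-antisym (begin
    2 * α A                      ≤⟨ m≤m+n _ _ ⟩
    2 * α A + ∣ N A (core A) ∣   ≤⟨ 2α+∣N[core]∣≤n+ξ ⟩
    n + ξ A                      ≡⟨ cong (n +_) ξ≡1 ⟩
    n + 1                        ≡⟨ +-comm n 1 ⟩
    suc n                        ∎) n<2α
    where open ≤-Reasoning

  ξ≡1⇒core-isolated : n < 2 * α A → ξ A ≡ 1 → x ∈ core A → Isolated G x
  ξ≡1⇒core-isolated n<2α ξ≡1 x∈core u = ¬-not λ Axu →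
    <⇒≱ (subst (∣ N A (core A) ∣ <_) ξ≡1 (∣N[core]∣<ξ n<2α)) (x∈p⇒0<∣p∣ (∈N⁺ A x∈core Axu))

  ⁅x⁆-stable : Stable A ⁅ x ⁆
  ⁅x⁆-stable {x} i∈ j∈ rewrite x∈⁅y⁆⇒x≡y x i∈ | x∈⁅y⁆⇒x≡y x j∈ = irrefl G x

  ∉maximum⇒adjacent : Maximum A S → x ∉ S → ∃[ y ] y ∈ S × A x y ≡ true
  ∉maximum⇒adjacent {S} {x} max-S x∉S = adjacent (0<∣p∣⇒Nonempty 0<∣S∩N[x]∣)
    where
    0<∣S∩N[x]∣ : 0 < ∣ S ∩ N A ⁅ x ⁆ ∣
    0<∣S∩N[x]∣ = subst (_≤ ∣ S ∩ N A ⁅ x ⁆ ∣) (∣⁅x⁆∣≡1 x) (∣c∣≤∣t∩N[c]∣ max-S ⁅x⁆-stable λ y∈⁅x⁆ →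
                   subst (_∉ S) (≡.sym (x∈⁅y⁆⇒x≡y x y∈⁅x⁆)) x∉S)
    adjacent : Nonempty (S ∩ N A ⁅ x ⁆) → ∃[ y ] y ∈ S × A x y ≡ true
    adjacent (y , y∈S∩N[x]) =
      let y∈S , y∈N[x]    = x∈p∩q⁻ S _ y∈S∩N[x]
          i , i∈⁅x⁆ , Aiy = ∈N⁻ A y∈N[x]
      in  y , y∈S , subst (λ i → A i y ≡ true) (x∈⁅y⁆⇒x≡y x i∈⁅x⁆) Aiy

  Isolated⇒∈core : Isolated G x → x ∈ core A
  Isolated⇒∈core {x} iso = ∈-core⁺ A λ {S} max-S → decidable-stable (x ∈? S) λ x∉S →
    let y , _ , Axy = ∉maximum⇒adjacent max-S x∉S in contradiction (≡.trans (≡.sym Axy) (iso y)) λ ()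

-- Adding an edge

module _ (A : Adj n) {u w : Fin n} where

  addEdge-Stable⁻ : Stable (addEdge A u w) S → Stable A S
  addEdge-Stable⁻ stable i∈S j∈S = ∨-conicalˡ _ _ (stable i∈S j∈S)

  addEdge-Stable⁺ : Stable A S → u ∉ S ⊎ w ∉ S → Stable (addEdge A u w) S
  addEdge-Stable⁺ stable (inj₁ u∉S) {i} {j} i∈S j∈S with i ≟ u | j ≟ u
  ... | yes refl | _        = contradiction i∈S u∉S
  ... | no _     | yes refl = contradiction j∈S u∉S
  ... | no _     | no _     rewrite stable i∈S j∈S = ∧-zeroʳ ⌊ i ≟ w ⌋
  addEdge-Stable⁺ stable (inj₂ w∉S) {i} {j} i∈S j∈S with i ≟ w | j ≟ w
  ... | yes refl | _        = contradiction i∈S w∉S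
  ... | no _     | yes refl = contradiction j∈S w∉S
  ... | no _     | no _     rewrite stable i∈S j∈S | ∧-zeroʳ ⌊ i ≟ u ⌋ = refl

  addEdge-uw : addEdge A u w u w ≡ true
  addEdge-uw with u ≟ u | w ≟ w
  ... | yes _  | yes _  = ∨-zeroʳ (A u w)
  ... | no u≢u | _      = contradiction refl u≢u
  ... | _      | no w≢w = contradiction refl w≢w

  α-addEdge≤α : α (addEdge A u w) ≤ α A
  α-addEdge≤α with maximum-exists (addEdge A u w)
  ... | S , stable , ∣S∣≡α′ = subst (_≤ α A) ∣S∣≡α′ (Stable⇒∣S∣≤α A (addEdge-Stable⁻ stable))

  α≤α-addEdge : Maximum A S → u ∉ S ⊎ w ∉ S → α A ≤ α (addEdge A u w)
  α≤α-addEdge (stable , ∣S∣≡α) u∉S⊎w∉S =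
    subst (_≤ _) ∣S∣≡α (Stable⇒∣S∣≤α (addEdge A u w) (addEdge-Stable⁺ stable u∉S⊎w∉S))

  α-addEdge≡α : u ∉ core A ⊎ w ∉ core A → α (addEdge A u w) ≡ α A
  α-addEdge≡α (inj₁ u∉core) with ∉-core⁻ A u∉core
  ... | S , max-S , u∉S = ≤-antisym α-addEdge≤α (α≤α-addEdge max-S (inj₁ u∉S))
  α-addEdge≡α (inj₂ w∉core) with ∉-core⁻ A w∉core
  ... | S , max-S , w∉S = ≤-antisym α-addEdge≤α (α≤α-addEdge max-S (inj₂ w∉S))

  α-addEdge≢α : u ∈ core A → w ∈ core A → α (addEdge A u w) ≢ α A
  α-addEdge≢α u∈core w∈core α′≡α with maximum-exists (addEdge A u w)
  ... | S , stable , ∣S∣≡α′ = contradiction (≡.trans (≡.sym addEdge-uw) (stable u∈S w∈S)) λ ()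
    where
    max-S : Maximum A S
    max-S = addEdge-Stable⁻ stable , ≡.trans ∣S∣≡α′ α′≡α
    u∈S = ∈-core⁻ A u∈core max-S
    w∈S = ∈-core⁻ A w∈core max-S

α⁺-stable⇔ξ≤1 : (G : Graph n) → α⁺-stable G ⇔ ξ (adj G) ≤ 1
α⁺-stable⇔ξ≤1 G = mk⇔ to from
  where
  to : α⁺-stable G → ξ (adj G) ≤ 1
  to α⁺ = subsingleton⇒∣p∣≤1 λ {u} {w} u∈core w∈core → decidable-stable (u ≟ w) λ u≢w →
    α-addEdge≢α (adj G) u∈core w∈core (α⁺ u w u≢w (core-stable (adj G) u∈core w∈core))
  from : ξ (adj G) ≤ 1 → α⁺-stable G
  from ξ≤1 u w u≢w _ with u ∈? core (adj G) | w ∈? core (adj G)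
  ... | no u∉core  | _          = α-addEdge≡α (adj G) (inj₁ u∉core)
  ... | yes _      | no w∉core  = α-addEdge≡α (adj G) (inj₂ w∉core)
  ... | yes u∈core | yes w∈core = contradiction ξ≤1 (<⇒≱ (x∈p∧y∈p∧x≢y⇒1<∣p∣ u∈core w∈core u≢w))

-- Deleting an isolated vertex

module _ {m} (G : Graph (suc m)) {v : Fin (suc m)} (iso : Isolated G v) where

  private
    A  = adj G
    A′ = adj (G -ᵥ v)

  removeAt-stable : Stable A T → Stable A′ (removeAt T v)
  removeAt-stable {T} stable i∈ j∈ =
    stable (∈-resp-lookup (lookup-removeAt T v _) i∈) (∈-resp-lookup (lookup-removeAt T v _) j∈)

  insertAt-stable : Stable A′ S → Stable A (insertAt S v inside)
  insertAt-stable {S} stable {i} {j} i∈ j∈ with ∈-insertAt⁻ S v i∈ | ∈-insertAt⁻ S v j∈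
  ... | inj₁ refl               | _                       = iso j
  ... | inj₂ _                  | inj₁ refl               = ≡.trans (sym G i v) (iso i)
  ... | inj₂ (i′ , refl , i′∈S) | inj₂ (j′ , refl , j′∈S) = stable i′∈S j′∈S

  α-delete : α A ≡ suc (α A′)
  α-delete with maximum-exists A | maximum-exists A′
  ... | T , stable-T , ∣T∣≡α | S , stable-S , ∣S∣≡α′ = ≤-antisym (begin
    α A                      ≡⟨ ≡.sym ∣T∣≡α ⟩
    ∣ T ∣                    ≤⟨ ∣p∣≤1+∣removeAt∣ T v ⟩
    suc ∣ removeAt T v ∣     ≤⟨ s≤s (Stable⇒∣S∣≤α A′ (removeAt-stable stable-T)) ⟩
    suc (α A′)               ∎) (begin
    suc (α A′)               ≡⟨ cong suc (≡.sym ∣S∣≡α′) ⟩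
    suc ∣ S ∣                ≡⟨ ≡.sym (∣insertAt-inside∣≡1+∣p∣ S v) ⟩
    ∣ insertAt S v inside ∣  ≤⟨ Stable⇒∣S∣≤α A (insertAt-stable stable-S) ⟩
    α A                      ∎)
    where open ≤-Reasoning

  core-delete⁺ : ∀ {j} → j ∈ core A′ → punchIn v j ∈ core A
  core-delete⁺ {j} j∈core = ∈-core⁺ A λ {T} (stable , ∣T∣≡α) →
    ∈-resp-lookup (lookup-removeAt T v j) (∈-core⁻ A′ j∈core
      (Stable∧α≤∣S∣⇒Maximum A′ (removeAt-stable stable) (≤-pred (begin
        suc (α A′)             ≡⟨ ≡.sym α-delete ⟩
        α A                    ≡⟨ ≡.sym ∣T∣≡α ⟩
        ∣ T ∣                  ≤⟨ ∣p∣≤1+∣removeAt∣ T v ⟩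
        suc ∣ removeAt T v ∣   ∎))))
    where open ≤-Reasoning

  core-delete⁻ : ∀ {j} → punchIn v j ∈ core A → j ∈ core A′
  core-delete⁻ {j} j∈core = ∈-core⁺ A′ λ {S} (stable , ∣S∣≡α′) →
    ∈-resp-lookup (insertAt-punchIn S v inside j) (∈-core⁻ A j∈core
      (Stable∧α≤∣S∣⇒Maximum A (insertAt-stable stable) (≤-reflexive (begin
        α A                       ≡⟨ α-delete ⟩
        suc (α A′)                ≡⟨ cong suc (≡.sym ∣S∣≡α′) ⟩
        suc ∣ S ∣                 ≡⟨ ≡.sym (∣insertAt-inside∣≡1+∣p∣ S v) ⟩
        ∣ insertAt S v inside ∣   ∎))))
    where open ≡-Reasoning

ξ[G-v]≡0⇔core≡⁅v⁆ : (G : Graph n) {v : Fin n} → Isolated G v →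
                    ξ (adj (G -ᵥ v)) ≡ 0 ⇔ core (adj G) ≡ ⁅ v ⁆
ξ[G-v]≡0⇔core≡⁅v⁆ {suc m} G {v} iso = mk⇔ to from
  where
  to : ξ (adj (G -ᵥ v)) ≡ 0 → core (adj G) ≡ ⁅ v ⁆
  to ξ′≡0 = unique-member⇒p≡⁅x⁆ (Isolated⇒∈core G iso) λ {x} x∈core → decidable-stable (x ≟ v) λ x≢v →
    n≮0 (subst (0 <_) ξ′≡0 (x∈p⇒0<∣p∣ (core-delete⁻ G iso
      (subst (_∈ core (adj G)) (≡.sym (punchIn-punchOut (x≢v ∘ ≡.sym))) x∈core))))
  from : core (adj G) ≡ ⁅ v ⁆ → ξ (adj (G -ᵥ v)) ≡ 0
  from core≡⁅v⁆ = Empty⇒∣p∣≡0 λ (j , j∈core′) →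
    punchInᵢ≢i v j (x∈⁅y⁆⇒x≡y v (subst (punchIn v j ∈_) core≡⁅v⁆ (core-delete⁺ G iso j∈core′)))

2α[G-v]≡n∸1 : (G : Graph n) {v : Fin n} → Isolated G v → 2 * α (adj G) ≡ suc n →
              2 * α (adj (G -ᵥ v)) ≡ n ∸ 1
2α[G-v]≡n∸1 {suc m} G {v} iso 2α≡2+m = suc-injective (suc-injective (begin
  2 + 2 * α (adj (G -ᵥ v))    ≡⟨ ≡.sym (*-suc 2 _) ⟩
  2 * suc (α (adj (G -ᵥ v)))  ≡⟨ cong (2 *_) (≡.sym (α-delete G iso)) ⟩
  2 * α (adj G)               ≡⟨ 2α≡2+m ⟩
  2 + m                       ∎))
  where open ≡-Reasoning

UniqueIsolatedVertexCondition : Graph n → Set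
UniqueIsolatedVertexCondition {n} G =
  Σ (Fin n) λ v → Isolated G v × ((w : Fin n) → Isolated G w → w ≡ v)
    × ξ (adj (G -ᵥ v)) ≡ 0 × 2 * α (adj (G -ᵥ v)) ≡ n ∸ 1

module _ (G : Graph n) (n<2α : n < 2 * α (adj G)) where

  α⁺-stable⇔ξ≡1 : α⁺-stable G ⇔ ξ (adj G) ≡ 1
  α⁺-stable⇔ξ≡1 = mk⇔ (λ α⁺ → ≤-antisym (to α⁺) 0<ξ) (from ∘ ≤-reflexive)
    where
    open Equivalence (α⁺-stable⇔ξ≤1 G)
    0<ξ : 0 < ξ (adj G)
    0<ξ = ≤-trans (s≤s z≤n) (∣N[core]∣<ξ G n<2α)

  ξ≡1⇒UniqueIsolatedVertexCondition : ξ (adj G) ≡ 1 → UniqueIsolatedVertexCondition G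
  ξ≡1⇒UniqueIsolatedVertexCondition ξ≡1 with ∣p∣≡1⇒p≡⁅x⁆ ξ≡1
  ... | v , core≡⁅v⁆ = v , iso , unique , Equivalence.from (ξ[G-v]≡0⇔core≡⁅v⁆ G iso) core≡⁅v⁆
                         , 2α[G-v]≡n∸1 G iso (2α≡1+n G n<2α ξ≡1)
    where
    iso : Isolated G v
    iso = ξ≡1⇒core-isolated G n<2α ξ≡1 (subst (v ∈_) (≡.sym core≡⁅v⁆) (x∈⁅x⁆ v))
    unique : (w : Fin n) → Isolated G w → w ≡ v
    unique w iso-w = x∈⁅y⁆⇒x≡y v (subst (w ∈_) core≡⁅v⁆ (Isolated⇒∈core G iso-w))

UniqueIsolatedVertexCondition⇒ξ≡1 : (G : Graph n) → UniqueIsolatedVertexCondition G → ξ (adj G) ≡ 1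
UniqueIsolatedVertexCondition⇒ξ≡1 G (v , iso , _ , ξ′≡0 , _) =
  ≡.trans (cong ∣_∣ (Equivalence.to (ξ[G-v]≡0⇔core≡⁅v⁆ G iso) ξ′≡0)) (∣⁅x⁆∣≡1 v)

proposition2 : (n : ℕ) (G : Graph n) → n < 2 * α (adj G) →
    (α⁺-stable G ⇔ (ξ (adj G) ≡ 1))
    × ((ξ (adj G) ≡ 1) ⇔
       Σ (Fin n) (λ v → Isolated G v × ((w : Fin n) → Isolated G w → w ≡ v)
         × ξ (adj (G -ᵥ v)) ≡ 0 × 2 * α (adj (G -ᵥ v)) ≡ n ∸ 1))
proposition2 n G n<2α =
  α⁺-stable⇔ξ≡1 G n<2α ,
  mk⇔ (ξ≡1⇒UniqueIsolatedVertexCondition G n<2α) (UniqueIsolatedVertexCondition⇒ξ≡1 G)
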